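{- Let $T$ be a tree poset with a unique maximum element and let $s\ge 2$ be an integer. Then for every $n$, $$Tr_{n-1}(n,T^s)\le La(n,T^{\otimes 2})+Tr_{n-1}(n,\bigvee\nolimits_{s-1})+1.$$
   Context: The Hasse diagram of a poset $P$ is the graph on $P$ in which $x,y$ are adjacent iff $x<y$ and there is no $z$ with $x<z<y$; $P$ is a tree poset if its Hasse diagram is a tree. For a tree poset $T$ with unique maximum element $m$, $T^k$ is the poset $(T\setminus\{m\})\cup\{m_1,\dots,m_k\}$ in which the $m_i$ form an antichain, $t<m_i$ for all $t\in T\setminus\{m\}$ and all $i$, and the order on $T\setminus\{m\}$ is inherited from $T$. $T^{\otimes r}$ is defined recursively on the height: if $T$ has one element then $T^{\otimes r}=T$; otherwise, if the maximum element $m$ of $T$ has children $c_1,\dots,c_c$ in the Hasse diagram and $T_j$ is the subposet of $T$ consisting of the elements $\le c_j$, then $T^{\otimes r}$ consists of a maximum element whose Hasse-diagram children are $m_1,\dots,m_{cr}$, where for each $1\le j\le c$ and $1\le i\le r$ the element $m_{(j-1)r+i}$ is the maximum element of a (disjoint) copy of $T_j^{\otimes r}$. For $t\ge1$, $\bigvee_t$ is the poset on $t+1$ elements $a,b_1,\dots,b_t$ with $a<b_j$ for all $j$ and no other relations. The sets $F_1,\dots,F_{|P|}$ form a copy of $P$ if there is a bijection $i:P\to\{F_1,\dots,F_{|P|}\}$ such that $p<_P p'$ implies $i(p)\subsetneq i(p')$; a family is $P$-free if it contains no copy of $P$. $La(n,P)$ is the maximum size of a $P$-free family in $2^{[n]}$.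 For $X$ a set and $\mathcal F$ a family, $\mathcal F|_X=\{F\cap X:F\in\mathcal F\}$. A family $\mathcal F\subseteq 2^{[n]}$ is $l$-trace $P$-free if $\mathcal F|_L$ is $P$-free for every $l$-element $L\subseteq[n]$, and $Tr_l(n,P)$ is the maximum size of an $l$-trace $P$-free family in $2^{[n]}$. -}

module Defs where

open import Data.Nat using (ℕ; zero; suc; _*_)
open import Data.Fin using (Fin; quotient)
open import Data.Fin.Subset using (Subset; _⊂_; _∩_; ∣_∣)
open import Data.List using (List; map)
open import Data.List.Membership.Propositional using (_∈_)
open import Data.Product using (Σ; _×_; _,_; ∃)
open import Data.Sum using (_⊎_; inj₁; inj₂)
open import Data.Unit using (⊤; tt)
open import Data.Empty using (⊥)
open import Relation.Binary.PropositionalEquality using (_≡_)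
open import Relation.Nullary using (¬_)
open import Function.Definitions using (Injective)

-- Posets (only the strict order relation is needed for copies)

record Poset : Set₁ where
  field
    Carrier : Set
    _<_     : Carrier → Carrier → Set

-- Tree posets with a unique maximum, as rooted trees.
-- node c f : the maximum element, whose Hasse-diagram children are the
-- maxima of the subtrees f 0, …, f (c-1).

data RTree : Set where
  node : (c : ℕ) → (Fin c → RTree) → RTree

data Pos : RTree → Set where
  root : ∀ {c f} → Pos (node c f)
  sub  : ∀ {c f} (j : Fin c) → Pos (f j) → Pos (node c f)

-- p ⊏ q : p is strictly below q (q is a proper ancestor of p)
data _⊏_ : {t : RTree} → Pos t → Pos t → Set where
  below-root : ∀ {c f} {j : Fin c} {p : Pos (f j)} → sub {c} {f} j p ⊏ root
  inside     : ∀ {c f} {j : Fin c} {p q : Pos (f j)} →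
               p ⊏ q → sub {c} {f} j p ⊏ sub j q

treePoset : RTree → Poset
treePoset t = record { Carrier = Pos t ; _<_ = _⊏_ }

-- T^k : the maximum is replaced by an antichain of k maxima above
-- everything else.

data PowLt {c : ℕ} {f : Fin c → RTree} (k : ℕ) :
     (Σ (Fin c) (λ j → Pos (f j))) ⊎ Fin k →
     (Σ (Fin c) (λ j → Pos (f j))) ⊎ Fin k → Set where
  old : ∀ {j j' p q} → sub {c} {f} j p ⊏ sub j' q →
        PowLt k (inj₁ (j , p)) (inj₁ (j' , q))
  top : ∀ {x i} → PowLt k (inj₁ x) (inj₂ i)

Pow : RTree → ℕ → Poset
Pow (node c f) k = record
  { Carrier = (Σ (Fin c) (λ j → Pos (f j))) ⊎ Fin k
  ; _<_     = PowLt {c} {f} k }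

-- T^{⊗r}: the child with index k of the new maximum (k = j*r + i,
-- i.e. the r consecutive children for the j-th original child) is the
-- maximum of a copy of T_j^{⊗r}.

tensor : ℕ → RTree → RTree
tensor r (node c f) = node (c * r) (λ k → tensor r (f (quotient r k)))

-- ⋁_t : a below b_1, …, b_t

data VeeLt (t : ℕ) : ⊤ ⊎ Fin t → ⊤ ⊎ Fin t → Set where
  up : ∀ {j} → VeeLt t (inj₁ tt) (inj₂ j)

Vee : ℕ → Poset
Vee t = record { Carrier = ⊤ ⊎ Fin t ; _<_ = VeeLt t }

-- Families of subsets of [n] (lists; freeness of the *set* of members)

Family : ℕ → Set
Family n = List (Subset n)

CopyOf : ∀ {n} → Poset → Family n → Set
CopyOf {n} P 𝓕 =
  Σ (Poset.Carrier P → Subset n) λ i →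
    (∀ p → i p ∈ 𝓕) ×
    Injective _≡_ _≡_ i ×
    (∀ p q → Poset._<_ P p q → i p ⊂ i q)

Free : ∀ {n} → Poset → Family n → Set
Free P 𝓕 = ¬ CopyOf P 𝓕

trace : ∀ {n} → Family n → Subset n → Family n
trace 𝓕 L = map (λ F → F ∩ L) 𝓕

TraceFree : ∀ {n} → ℕ → Poset → Family n → Set
TraceFree {n} l P 𝓕 = (L : Subset n) → ∣ L ∣ ≡ l → Free P (trace 𝓕 L)

-- Let 𝓕 be (n-1)-trace T^s-free and k = s-1.  Call F ∈ 𝓕 covered if for
-- some (n-1)-set L the trace F ∩ L lies strictly below k distinct members
-- of 𝓕|_L.  The uncovered members form an (n-1)-trace ⋁_k-free family,
-- since a copy of ⋁_k in a trace would witness that its bottom is covered.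
-- The covered members form a T^{⊗2}-free family: from a copy of T^{⊗2} whose
-- top M is covered on L we extract a copy of T in 𝓕|_L with top M ∩ L, and
-- the k sets above M ∩ L turn it into a copy of T^s in 𝓕|_L.
--
-- As |L| = n-1, at most two sets
-- share a trace on L, so "distinct, equal trace" is a matching on T^{⊗2}.
-- T^{⊗2} contains 2 copies of every child, and a choice β of one copy per
-- position of T picks an embedded copy of T, and every matching is
-- avoided by some choice.  This is done by eliminating the positions of T in
-- post-order: fixing the copy at a position ℓ only affects ℓ itself, so
-- the two candidate copies of ℓ may be contracted into a new matching on
-- the remaining positions.
module Submission where

open import Defs
open import Data.Nat using (ℕ; zero; suc; _+_; _∸_; _≤_; s≤s; z≤n)
import Data.Nat.Properties as ℕP
open import Data.Bool as Bool using (Bool; true; false; if_then_else_)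
open import Data.Bool.Properties using (∧-identityʳ)
open import Data.Maybe using (Maybe; just; nothing)
open import Data.Fin as Fin using (Fin; quotient; remainder; combine)
open import Data.Fin.Patterns using (0F; 1F)
open import Data.Fin.Properties using (remQuot-combine; all?)
open import Data.Fin.Subset using (Subset; _⊆_; _⊂_; _∩_; ∣_∣; inside; outside; ⊤)
open import Data.Fin.Subset.Properties
  using (⊂-irref; ⊂-trans; drop-∷-⊆; out⊂; out⊂in; s⊂s; x∈p∩q⁺; x∈p∩q⁻; ∣p∣≡n⇒p≡⊤; ∩-identityʳ; anySubset?; _⊂?_)
open import Data.Vec as Vec using (Vec; []; _∷_; lookup; tabulate)
open import Data.Vec.Properties using (≡-dec; ∷-injectiveˡ; ∷-injectiveʳ; lookup∘tabulate)
open import Data.List as List using (List; []; _∷_; _++_; map; concat; filter; length)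
open import Data.List.Membership.Propositional using (_∈_; find; lose)
open import Data.List.Membership.Propositional.Properties
  using (∈-map⁺; ∈-map⁻; ∈-++⁺ˡ; ∈-++⁺ʳ; ∈-concat⁺′; ∈-tabulate⁺; ∈-filter⁻)
open import Data.List.Relation.Unary.All as All using (All; []; _∷_)
import Data.List.Relation.Unary.All.Properties as AllP
open import Data.List.Relation.Unary.Any as Any using (Any; here; there)
open import Data.List.Relation.Unary.AllPairs as AllPairs using (AllPairs; []; _∷_)
import Data.List.Relation.Unary.AllPairs.Properties as AllPairsP
open import Data.List.Relation.Unary.Unique.Propositional using (Unique)
import Data.List.Relation.Unary.Unique.Propositional.Properties as UniqueP
open import Data.Product using (Σ; _×_; _,_; proj₁; proj₂)
open import Data.Sum as Sum using (_⊎_; inj₁; inj₂)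
open import Data.Unit using (tt)
open import Data.Empty using (⊥-elim)
open import Function using (_∘_)
open import Function.Definitions using (Injective)
open import Relation.Binary.PropositionalEquality
open import Relation.Binary.Definitions using (DecidableEquality)
open import Relation.Nullary using (¬_; Dec; yes; no; does)
open import Relation.Nullary.Decidable using (_×-dec_; _⊎-dec_; ¬?; _→-dec_; map′)
open import Relation.Unary using (Decidable)
open import Relation.Unary.Properties using (∁?)

-- Positions of a rooted tree

_⊑_ : ∀ {t} → Pos t → Pos t → Set
q ⊑ ℓ = q ≡ ℓ ⊎ q ⊏ ℓ

rootOf : (t : RTree) → Pos t
rootOf (node c f) = root

⊑-rootOf : ∀ {t} (q : Pos t) → q ⊑ rootOf t
⊑-rootOf {node c f} root      = inj₁ refl
⊑-rootOf {node c f} (sub j q) = inj₂ below-root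

⊑-sub : ∀ {c f} {j : Fin c} {q r : Pos (f j)} → q ⊑ r → sub {c} {f} j q ⊑ sub j r
⊑-sub (inj₁ refl) = inj₁ refl
⊑-sub (inj₂ q⊏r)  = inj₂ (inside q⊏r)

⊑-sub⁻ : ∀ {c f} {j : Fin c} {q r : Pos (f j)} → sub {c} {f} j q ⊑ sub j r → q ⊑ r
⊑-sub⁻ (inj₁ refl)          = inj₁ refl
⊑-sub⁻ (inj₂ (inside q⊏r)) = inj₂ q⊏r

⊑-sameChild : ∀ {c f} {j j' : Fin c} {q : Pos (f j)} {r : Pos (f j')} →
              sub {c} {f} j q ⊑ sub j' r → j ≡ j'
⊑-sameChild (inj₁ refl)       = refl
⊑-sameChild (inj₂ (inside _)) = refl

⊏-irrefl : ∀ {t} {p : Pos t} → ¬ (p ⊏ p)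
⊏-irrefl (inside p⊏p) = ⊏-irrefl p⊏p

sub-injective : ∀ {c f} {j : Fin c} {p q : Pos (f j)} → sub {c} {f} j p ≡ sub j q → p ≡ q
sub-injective refl = refl

_≟P_ : ∀ {t} → DecidableEquality (Pos t)
root    ≟P root     = yes refl
root    ≟P sub _ _  = no λ ()
sub _ _ ≟P root     = no λ ()
sub j p ≟P sub j' q with j Fin.≟ j'
... | no j≢j' = no λ { refl → j≢j' refl }
... | yes refl with p ≟P q
...   | yes refl = yes refl
...   | no p≢q   = no (p≢q ∘ sub-injective)

postorder : (t : RTree) → List (Pos t)
postorder (node c f) = concat (List.tabulate λ j → map (sub j) (postorder (f j))) ++ root ∷ []

∈-postorder : ∀ {t} (p : Pos t) → p ∈ postorder t
∈-postorder {node c f} root      = ∈-++⁺ʳ _ (here refl)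
∈-postorder {node c f} (sub j p) =
  ∈-++⁺ˡ (∈-concat⁺′ (∈-map⁺ (sub j) (∈-postorder p)) (∈-tabulate⁺ j))

SubtreeFirst : ∀ {t} → Pos t → Pos t → Set
SubtreeFirst ℓ q = ¬ q ⊑ ℓ

postorder-subtreeFirst : ∀ t → AllPairs SubtreeFirst (postorder t)
postorder-subtreeFirst (node c f) =
  AllPairsP.++⁺ (AllPairsP.concat⁺ (AllP.tabulate⁺ withinChild) (AllPairsP.tabulate⁺ acrossChildren))
                (All.[] ∷ [])
                (AllP.concat⁺ (AllP.tabulate⁺ beforeRoot))
  where
  withinChild : ∀ j → AllPairs SubtreeFirst (map (sub j) (postorder (f j)))
  withinChild j = AllPairsP.map⁺ (AllPairs.map (λ q⋢ℓ → q⋢ℓ ∘ ⊑-sub⁻) (postorder-subtreeFirst (f j)))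

  acrossChildren : ∀ {i j} → i ≢ j →
    All (λ p → All (SubtreeFirst p) (map (sub j) (postorder (f j)))) (map (sub i) (postorder (f i)))
  acrossChildren i≢j = AllP.map⁺ (All.universal (λ _ →
    AllP.map⁺ (All.universal (λ _ q⊑p → i≢j (sym (⊑-sameChild q⊑p))) _)) _)

  rootLast : ∀ {j} {p : Pos (f j)} → SubtreeFirst (sub {c} {f} j p) root
  rootLast (inj₁ ())
  rootLast (inj₂ ())

  beforeRoot : ∀ j → All (λ p → All (SubtreeFirst p) (root ∷ [])) (map (sub j) (postorder (f j)))
  beforeRoot j = AllP.map⁺ (All.universal (λ _ → rootLast ∷ []) _)

-- Positions of T^{⊗r} as labelled paths
--
-- Every position of T^{⊗r} is reached from the root by steps into children,
-- a step recording both the child j of T and which of its r copies is used.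

data Path (r : ℕ) : RTree → Set where
  end  : ∀ {c f} → Path r (node c f)
  step : ∀ {c f} (j : Fin c) → Fin r → Path r (f j) → Path r (node c f)

quotient-combine : ∀ {c r} (j : Fin c) (b : Fin r) → quotient r (combine j b) ≡ j
quotient-combine j b = cong proj₁ (remQuot-combine j b)

remainder-combine : ∀ {c r} (j : Fin c) (b : Fin r) → remainder {c} r (combine j b) ≡ b
remainder-combine j b = cong proj₂ (remQuot-combine j b)

-- the copy k = combine j b of the children of T^{⊗r} is a copy of T_j^{⊗r}
toTensor : ∀ {r t} → Path r t → Pos (tensor r t)
toTensor end = root
toTensor {r} {node c f} (step j b d) =
  sub (combine j b) (subst (λ i → Pos (tensor r (f i))) (sym (quotient-combine j b)) (toTensor d))

fromTensor : ∀ {r t} → Pos (tensor r t) → Path r t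
fromTensor {r} {node c f} root      = end
fromTensor {r} {node c f} (sub k x) = step (quotient r k) (remainder {c} r k) (fromTensor x)

fromTensor-toTensor : ∀ {r t} (d : Path r t) → fromTensor (toTensor d) ≡ d
fromTensor-toTensor end = refl
fromTensor-toTensor {r} {node c f} (step j b d) =
  trans (reindex (combine j b) j (quotient-combine j b) (toTensor d))
        (cong₂ (step j) (remainder-combine j b) (fromTensor-toTensor d))
  where
  reindex : ∀ k j (e : quotient r k ≡ j) (y : Pos (tensor r (f j))) →
            fromTensor {r} {node c f} (sub k (subst (λ i → Pos (tensor r (f i))) (sym e) y))
            ≡ step j (remainder {c} r k) (fromTensor y)
  reindex k _ refl y = refl

toTensor-injective : ∀ {r t} {d e : Path r t} → toTensor d ≡ toTensor e → d ≡ e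
toTensor-injective {d = d} {e} eq =
  trans (sym (fromTensor-toTensor d)) (trans (cong fromTensor eq) (fromTensor-toTensor e))

anyPath? : ∀ {r t} {P : Path r t → Set} → (∀ d → Dec (P d)) → Dec (Σ (Path r t) P)
anyPath? {r} {t} {P} P? with Any.any? P? (map fromTensor (postorder (tensor r t)))
... | yes found = yes (Any.satisfied found)
... | no none   = no λ (d , pd) → none (Any.map (λ { refl → pd }) (listed d))
  where
  listed : ∀ d → d ∈ map fromTensor (postorder (tensor r t))
  listed d = subst (_∈ _) (fromTensor-toTensor d) (∈-map⁺ fromTensor (∈-postorder (toTensor d)))

forget : ∀ {r t} → Path r t → Pos t
forget end          = root
forget (step j _ d) = sub j (forget d)

isEnd : ∀ {r t} → Path r t → Bool
isEnd end          = true
isEnd (step _ _ _) = false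

isEnd-false : ∀ {r t} (d : Path r t) → forget d ≢ rootOf t → isEnd d ≡ false
isEnd-false end          d≢root = ⊥-elim (d≢root refl)
isEnd-false (step _ _ _) _      = refl

-- recopy d x : the path d with its last step redirected to copy x
recopy : ∀ {r t} → Path r t → Fin r → Path r t
recopy end          x = end
recopy (step j b d) x = if isEnd d then step j x d else step j b (recopy d x)

lastCopy : ∀ {r t} → Path r t → Maybe (Fin r)
lastCopy end          = nothing
lastCopy (step j b d) = if isEnd d then just b else lastCopy d

isEnd-recopy : ∀ {r t} (d : Path r t) x → isEnd (recopy d x) ≡ isEnd d
isEnd-recopy end          x = refl
isEnd-recopy (step j b d) x with isEnd d
... | true  = refl
... | false = refl

forget-recopy : ∀ {r t} (d : Path r t) x → forget (recopy d x) ≡ forget d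
forget-recopy end          x = refl
forget-recopy (step j b d) x with isEnd d
... | true  = refl
... | false = cong (sub j) (forget-recopy d x)

lastCopy-recopy : ∀ {r t} (d : Path r t) x → isEnd d ≡ false → lastCopy (recopy d x) ≡ just x
lastCopy-recopy (step j b d) x _ with isEnd d in d-end
... | true  rewrite d-end = refl
... | false rewrite isEnd-recopy d x | d-end = lastCopy-recopy d x d-end

recopy-recopy : ∀ {r t} (d : Path r t) x y → recopy (recopy d x) y ≡ recopy d y
recopy-recopy end          x y = refl
recopy-recopy (step j b d) x y with isEnd d in d-end
... | true  rewrite d-end = refl
... | false rewrite isEnd-recopy d x | d-end = cong (step j b) (recopy-recopy d x y)

recopy-transfer : ∀ {r t} (d d' : Path r t) x y → recopy d x ≡ recopy d' x → recopy d y ≡ recopy d' y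
recopy-transfer d d' x y eq =
  trans (sym (recopy-recopy d x y)) (trans (cong (λ e → recopy e y) eq) (recopy-recopy d' x y))

recopy-distinct : ∀ {r t} (d d' : Path r t) x y → isEnd d ≡ false → x ≢ y → recopy d x ≢ recopy d' y
recopy-distinct d d' x y d-step x≢y eq = x≢y (just-injective (begin
  just x                  ≡⟨ sym (lastCopy-recopy d x d-step) ⟩
  lastCopy (recopy d x)   ≡⟨ cong lastCopy eq ⟩
  lastCopy (recopy d' y)  ≡⟨ lastCopy-recopy d' y d'-step ⟩
  just y                  ∎))
  where
  open ≡-Reasoning
  just-injective : ∀ {a b : Fin _} → just a ≡ just b → a ≡ b
  just-injective refl = refl
  d'-step : isEnd d' ≡ false
  d'-step = trans (sym (isEnd-recopy d' y)) (trans (cong isEnd (sym eq)) (trans (isEnd-recopy d x) d-step))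

-- Choices of copies
--
-- A choice β : Pos T → Fin r selects copy β p for every position p ≠ root;
-- pick β p is the corresponding copy of p in T^{⊗r}.  The copy of p only
-- depends on the choices along the path from the root to p.

pick : ∀ {r t} → (Pos t → Fin r) → Pos t → Path r t
pick β root = end
pick {t = node c f} β (sub j p) = step j (β (sub j (rootOf (f j)))) (pick (β ∘ sub j) p)

forget-pick : ∀ {r t} (β : Pos t → Fin r) p → forget (pick β p) ≡ p
forget-pick β root      = refl
forget-pick β (sub j p) = cong (sub j) (forget-pick (β ∘ sub j) p)

pick-injective : ∀ {r t} (β : Pos t → Fin r) {p q} → pick β p ≡ pick β q → p ≡ q
pick-injective β {p} {q} eq = trans (sym (forget-pick β p)) (trans (cong forget eq) (forget-pick β q))

isEnd-pick-rootOf : ∀ {r t} (β : Pos t → Fin r) → isEnd (pick β (rootOf t)) ≡ true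
isEnd-pick-rootOf {t = node c f} β = refl

pick-rootOf-independent : ∀ {r t} (β β' : Pos t → Fin r) → pick β (rootOf t) ≡ pick β' (rootOf t)
pick-rootOf-independent {t = node c f} β β' = refl

pick-monotone : ∀ {r t} (β : Pos t → Fin r) {p q : Pos t} → p ⊏ q → toTensor (pick β p) ⊏ toTensor (pick β q)
pick-monotone β below-root = below-root
pick-monotone {r} {node c f} β (inside {j = j} p⊏q) =
  inside (subst-⊏ (sym (quotient-combine j (β (sub j (rootOf (f j)))))) (pick-monotone (β ∘ sub j) p⊏q))
  where
  subst-⊏ : ∀ {i i'} (e : i ≡ i') {x y : Pos (tensor r (f i))} → x ⊏ y →
            subst (λ k → Pos (tensor r (f k))) e x ⊏ subst (λ k → Pos (tensor r (f k))) e y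
  subst-⊏ refl x⊏y = x⊏y

pick-local : ∀ {r t} (β β' : Pos t → Fin r) (q : Pos t) → (∀ p → q ⊑ p → β p ≡ β' p) → pick β q ≡ pick β' q
pick-local β β' root _ = refl
pick-local {t = node c f} β β' (sub j q) agree =
  cong₂ (step j) (agree (sub j (rootOf (f j))) (⊑-sub (⊑-rootOf q)))
                 (pick-local (β ∘ sub j) (β' ∘ sub j) q (λ p q⊑p → agree (sub j p) (⊑-sub q⊑p)))

_[_≔_] : ∀ {r t} → (Pos t → Fin r) → Pos t → Fin r → Pos t → Fin r
(β [ ℓ ≔ b ]) p = if does (p ≟P ℓ) then b else β p

update-here : ∀ {r t} (β : Pos t → Fin r) ℓ b → (β [ ℓ ≔ b ]) ℓ ≡ b
update-here β ℓ b with ℓ ≟P ℓ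
... | yes _   = refl
... | no ℓ≢ℓ = ⊥-elim (ℓ≢ℓ refl)

update-elsewhere : ∀ {r t} (β : Pos t → Fin r) ℓ b p → p ≢ ℓ → (β [ ℓ ≔ b ]) p ≡ β p
update-elsewhere β ℓ b p p≢ℓ with p ≟P ℓ
... | yes p≡ℓ = ⊥-elim (p≢ℓ p≡ℓ)
... | no _    = refl

update-sub : ∀ {r c f} (β : Pos (node c f) → Fin r) j ℓ b →
             (β [ sub j ℓ ≔ b ]) ∘ sub j ≗ (β ∘ sub j) [ ℓ ≔ b ]
update-sub β j ℓ b p with p ≟P ℓ
... | yes refl = update-here β (sub j ℓ) b
... | no p≢ℓ   = update-elsewhere β (sub j ℓ) b (sub j p) (p≢ℓ ∘ sub-injective)

pick-update : ∀ {r t} (β : Pos t → Fin r) ℓ b → ℓ ≢ rootOf t → pick (β [ ℓ ≔ b ]) ℓ ≡ recopy (pick β ℓ) b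
pick-update β root b ℓ≢root = ⊥-elim (ℓ≢root refl)
pick-update {t = node c f} β (sub j ℓ) b _ with ℓ ≟P rootOf (f j)
... | yes refl rewrite isEnd-pick-rootOf (β ∘ sub j) =
  cong₂ (step j) (update-here β _ b) (pick-rootOf-independent _ _)
... | no ℓ≢root
  rewrite isEnd-false (pick (β ∘ sub j) ℓ) (λ e → ℓ≢root (trans (sym (forget-pick (β ∘ sub j) ℓ)) e)) =
  cong₂ (step j) (update-elsewhere β (sub j ℓ) b _ (λ e → ℓ≢root (sym (sub-injective e))))
                 (trans (pick-local _ _ ℓ (λ p _ → update-sub β j ℓ b p))
                        (pick-update (β ∘ sub j) ℓ b ℓ≢root))

-- Choices avoiding a matching

record Matching (t : RTree) : Set₁ where
  field
    _~_          : Path 2 t → Path 2 t → Set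
    ~-sym        : ∀ {u v} → u ~ v → v ~ u
    ~-functional : ∀ {u v w} → u ~ v → u ~ w → v ≡ w
    _~?_         : ∀ u v → Dec (u ~ v)

Avoids : ∀ {t} → Matching t → List (Pos t) → (Pos t → Fin 2) → Set
Avoids M xs β = ∀ {p q} → p ∈ xs → q ∈ xs → p ≢ q → ¬ Matching._~_ M (pick β p) (pick β q)

-- For every path d to ℓ the two
-- copies recopy d 0F and recopy d 1F are identified: their partners become
-- partners of each other.  Pairs involving a copy of ℓ are dropped.
module Contraction {t} (M : Matching t) (ℓ : Pos t) (ℓ≢root : ℓ ≢ rootOf t) where
  open Matching M

  _≈_ : Path 2 t → Path 2 t → Set
  u ≈ v = (u ~ v × forget u ≢ ℓ × forget v ≢ ℓ)
        ⊎ (Σ (Path 2 t) λ d → forget d ≡ ℓ × u ~ recopy d 0F × v ~ recopy d 1F)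
        ⊎ (Σ (Path 2 t) λ d → forget d ≡ ℓ × v ~ recopy d 0F × u ~ recopy d 1F)

  partner-off-ℓ : ∀ {u v} (d : Path 2 t) x → u ~ v → forget v ≢ ℓ → forget d ≡ ℓ → ¬ u ~ recopy d x
  partner-off-ℓ d x u~v v≢ℓ d-ℓ u~dx =
    v≢ℓ (trans (cong forget (~-functional u~v u~dx)) (trans (forget-recopy d x) d-ℓ))

  copies-differ : ∀ (d d' : Path 2 t) → forget d ≡ ℓ → recopy d 0F ≢ recopy d' 1F
  copies-differ d d' d-ℓ = recopy-distinct d d' 0F 1F (isEnd-false d (λ e → ℓ≢root (trans (sym d-ℓ) e))) λ ()

  ≈-sym : ∀ {u v} → u ≈ v → v ≈ u
  ≈-sym (inj₁ (u~v , u≢ℓ , v≢ℓ)) = inj₁ (~-sym u~v , v≢ℓ , u≢ℓ)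
  ≈-sym (inj₂ (inj₁ via))       = inj₂ (inj₂ via)
  ≈-sym (inj₂ (inj₂ via))       = inj₂ (inj₁ via)

  same-copy : ∀ {u v w} (d d' : Path 2 t) x y → u ~ recopy d x → u ~ recopy d' x → v ~ recopy d y → w ~ recopy d' y → v ≡ w
  same-copy {w = w} d d' x y u~dx u~d'x v~dy w~d'y =
    ~-functional (~-sym v~dy) (subst (_~ w) (sym (recopy-transfer d d' x y (~-functional u~dx u~d'x))) (~-sym w~d'y))

  ≈-functional : ∀ {u v w} → u ≈ v → u ≈ w → v ≡ w
  ≈-functional (inj₁ (u~v , _ , _)) (inj₁ (u~w , _ , _)) = ~-functional u~v u~w
  ≈-functional (inj₁ (u~v , _ , v≢ℓ)) (inj₂ (inj₁ (d , d-ℓ , u~d0 , _))) = ⊥-elim (partner-off-ℓ d 0F u~v v≢ℓ d-ℓ u~d0)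
  ≈-functional (inj₁ (u~v , _ , v≢ℓ)) (inj₂ (inj₂ (d , d-ℓ , _ , u~d1))) = ⊥-elim (partner-off-ℓ d 1F u~v v≢ℓ d-ℓ u~d1)
  ≈-functional (inj₂ (inj₁ (d , d-ℓ , u~d0 , _))) (inj₁ (u~w , _ , w≢ℓ)) = ⊥-elim (partner-off-ℓ d 0F u~w w≢ℓ d-ℓ u~d0)
  ≈-functional (inj₂ (inj₂ (d , d-ℓ , _ , u~d1))) (inj₁ (u~w , _ , w≢ℓ)) = ⊥-elim (partner-off-ℓ d 1F u~w w≢ℓ d-ℓ u~d1)
  ≈-functional (inj₂ (inj₁ (d , _ , u~d0 , v~d1))) (inj₂ (inj₁ (d' , _ , u~d'0 , w~d'1))) =
    same-copy d d' 0F 1F u~d0 u~d'0 v~d1 w~d'1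
  ≈-functional (inj₂ (inj₂ (d , _ , v~d0 , u~d1))) (inj₂ (inj₂ (d' , _ , w~d'0 , u~d'1))) =
    same-copy d d' 1F 0F u~d1 u~d'1 v~d0 w~d'0
  ≈-functional (inj₂ (inj₁ (d , d-ℓ , u~d0 , _))) (inj₂ (inj₂ (d' , _ , _ , u~d'1))) =
    ⊥-elim (copies-differ d d' d-ℓ (~-functional u~d0 u~d'1))
  ≈-functional (inj₂ (inj₂ (d , _ , _ , u~d1))) (inj₂ (inj₁ (d' , d'-ℓ , u~d'0 , _))) =
    ⊥-elim (copies-differ d' d d'-ℓ (~-functional u~d'0 u~d1))

  _≈?_ : ∀ u v → Dec (u ≈ v)
  u ≈? v = (u ~? v ×-dec ¬? (forget u ≟P ℓ) ×-dec ¬? (forget v ≟P ℓ))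
    ⊎-dec anyPath? (λ d → (forget d ≟P ℓ) ×-dec (u ~? recopy d 0F) ×-dec (v ~? recopy d 1F))
    ⊎-dec anyPath? (λ d → (forget d ≟P ℓ) ×-dec (v ~? recopy d 0F) ×-dec (u ~? recopy d 1F))

  contracted : Matching t
  contracted = record { _~_ = _≈_ ; ~-sym = ≈-sym ; ~-functional = ≈-functional ; _~?_ = _≈?_ }

  -- A choice avoiding the contraction on ys, where ys contains nothing from
  -- the subtree of ℓ, becomes a choice avoiding M on ℓ ∷ ys by fixing the
  -- copy of ℓ: copy 0F if that copy has no partner among the copies of ys,
  -- and copy 1F otherwise (then 1F has none, or the contraction would
  -- match two members of ys).
  module Extension (ys : List (Pos t)) (ℓ-first : All (SubtreeFirst ℓ) ys)
                   (β : Pos t → Fin 2) (β-avoids : Avoids contracted ys β) where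
    d₀ : Path 2 t
    d₀ = pick β ℓ

    outside-ℓ : ∀ {q} → q ∈ ys → q ≢ ℓ
    outside-ℓ q∈ q≡ℓ = All.lookup ℓ-first q∈ (inj₁ q≡ℓ)

    unchanged : ∀ b {q} → q ∈ ys → pick (β [ ℓ ≔ b ]) q ≡ pick β q
    unchanged b {q} q∈ = pick-local _ _ q λ p q⊑p →
      update-elsewhere β ℓ b p (λ p≡ℓ → All.lookup ℓ-first q∈ (subst (q ⊑_) p≡ℓ q⊑p))

    forget-away : ∀ {q} → q ∈ ys → forget (pick β q) ≢ ℓ
    forget-away {q} q∈ e = outside-ℓ q∈ (trans (sym (forget-pick β q)) e)

    avoidsWith : ∀ b → (∀ {q} → q ∈ ys → ¬ recopy d₀ b ~ pick β q) → Avoids M (ℓ ∷ ys) (β [ ℓ ≔ b ])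
    avoidsWith b free (here refl) (here refl) p≢q _ = p≢q refl
    avoidsWith b free (here refl) (there q∈) _ m =
      free q∈ (subst₂ _~_ (pick-update β ℓ b ℓ≢root) (unchanged b q∈) m)
    avoidsWith b free (there p∈) (here refl) _ m =
      free p∈ (subst₂ _~_ (pick-update β ℓ b ℓ≢root) (unchanged b p∈) (~-sym m))
    avoidsWith b free (there p∈) (there q∈) p≢q m =
      β-avoids p∈ q∈ p≢q (inj₁ (subst₂ _~_ (unchanged b p∈) (unchanged b q∈) m , forget-away p∈ , forget-away q∈))

    partnerless₁ : Any (λ q → pick β q ~ recopy d₀ 0F) ys → ∀ {q} → q ∈ ys → ¬ recopy d₀ 1F ~ pick β q
    partnerless₁ has₀ {q} q∈ d₁~q with find has₀
    ... | q₀ , q₀∈ , q₀~d₀ = β-avoids q₀∈ q∈ q₀≢q (inj₂ (inj₁ (d₀ , forget-pick β ℓ , q₀~d₀ , ~-sym d₁~q)))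
      where
      q₀≢q : q₀ ≢ q
      q₀≢q refl = copies-differ d₀ d₀ (forget-pick β ℓ) (~-functional q₀~d₀ (~-sym d₁~q))

    extension : Σ (Pos t → Fin 2) (Avoids M (ℓ ∷ ys))
    extension with Any.any? (λ q → pick β q ~? recopy d₀ 0F) ys
    ... | no  none = β [ ℓ ≔ 0F ] , avoidsWith 0F (λ q∈ d₀~q → none (lose q∈ (~-sym d₀~q)))
    ... | yes has₀ = β [ ℓ ≔ 1F ] , avoidsWith 1F (partnerless₁ has₀)

-- Every matching is avoided on a list in which no position is followed by
-- a member of its subtree; positions are eliminated from the front.
avoidingChoice : ∀ {t} (xs : List (Pos t)) → AllPairs SubtreeFirst xs → (M : Matching t) →
                 Σ (Pos t → Fin 2) (Avoids M xs)
avoidingChoice [] _ M = (λ _ → 0F) , λ ()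
avoidingChoice {t} (ℓ ∷ ys) (ℓ-first ∷ ys-ordered) M with ℓ ≟P rootOf t
... | yes refl = (λ _ → 0F) , onlyRoot
  where
  -- every member of ys lies below the root, so ys is empty
  onlyRoot : Avoids M (rootOf t ∷ ys) (λ _ → 0F)
  onlyRoot (here refl) (here refl) p≢q _ = p≢q refl
  onlyRoot (there p∈) _ _ _ = All.lookup ℓ-first p∈ (⊑-rootOf _)
  onlyRoot (here _) (there q∈) _ _ = All.lookup ℓ-first q∈ (⊑-rootOf _)
... | no ℓ≢root =
  let open Contraction M ℓ ℓ≢root
      β , β-avoids = avoidingChoice ys ys-ordered contracted
  in Extension.extension ys ℓ-first β β-avoids

-- Subsets and traces

_≟S_ : ∀ {n} → DecidableEquality (Subset n)
_≟S_ = ≡-dec Bool._≟_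

pigeonhole : (x y z : Bool) → x ≡ y ⊎ x ≡ z ⊎ y ≡ z
pigeonhole true  true  _     = inj₁ refl
pigeonhole false false _     = inj₁ refl
pigeonhole true  false true  = inj₂ (inj₁ refl)
pigeonhole true  false false = inj₂ (inj₂ refl)
pigeonhole false true  false = inj₂ (inj₁ refl)
pigeonhole false true  true  = inj₂ (inj₂ refl)

∧-true-injective : ∀ {x y} → x Bool.∧ true ≡ y Bool.∧ true → x ≡ y
∧-true-injective {x} {y} eq = trans (sym (∧-identityʳ x)) (trans eq (∧-identityʳ y))

∩-⊤-injective : ∀ {n} {A B : Subset n} → A ∩ ⊤ ≡ B ∩ ⊤ → A ≡ B
∩-⊤-injective {A = A} {B} eq = trans (sym (∩-identityʳ A)) (trans eq (∩-identityʳ B))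

-- On a set L missing at most one point, sets with equal traces differ at
-- most in that point; so among three sets with equal traces two coincide.
trace-collision : ∀ {n} (L A B C : Subset n) → ∣ L ∣ ≡ n ∸ 1 →
                  A ∩ L ≡ B ∩ L → A ∩ L ≡ C ∩ L → A ≡ B ⊎ A ≡ C ⊎ B ≡ C
trace-collision [] [] [] [] _ _ _ = inj₁ refl
trace-collision {suc zero} (inside ∷ L) _ _ _ ()
trace-collision {suc (suc n)} (inside ∷ L) (a ∷ A) (b ∷ B) (c ∷ C) ∣L∣ eqB eqC
  with ∧-true-injective (∷-injectiveˡ eqB) | ∧-true-injective (∷-injectiveˡ eqC)
... | refl | refl =
  Sum.map (cong (a ∷_)) (Sum.map (cong (a ∷_)) (cong (a ∷_)))
          (trace-collision L A B C (ℕP.suc-injective ∣L∣) (∷-injectiveʳ eqB) (∷-injectiveʳ eqC))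
trace-collision {suc n} (outside ∷ L) (a ∷ A) (b ∷ B) (c ∷ C) ∣L∣ eqB eqC
  with ∣p∣≡n⇒p≡⊤ {p = L} ∣L∣
... | refl with ∩-⊤-injective (∷-injectiveʳ eqB) | ∩-⊤-injective (∷-injectiveʳ eqC)
...   | refl | refl = Sum.map (cong (_∷ A)) (Sum.map (cong (_∷ A)) (cong (_∷ A))) (pigeonhole a b c)

⊆∧≢⇒⊂ : ∀ {n} {p q : Subset n} → p ⊆ q → p ≢ q → p ⊂ q
⊆∧≢⇒⊂ {p = []}          {[]}          _   p≢q = ⊥-elim (p≢q refl)
⊆∧≢⇒⊂ {p = outside ∷ p} {outside ∷ q} p⊆q p≢q = out⊂ (⊆∧≢⇒⊂ (drop-∷-⊆ p⊆q) (p≢q ∘ cong (outside ∷_)))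
⊆∧≢⇒⊂ {p = outside ∷ p} {inside ∷ q}  p⊆q _   = out⊂in (drop-∷-⊆ p⊆q)
⊆∧≢⇒⊂ {p = inside ∷ p}  {outside ∷ q} p⊆q _   with p⊆q Vec.here
... | ()
⊆∧≢⇒⊂ {p = inside ∷ p}  {inside ∷ q}  p⊆q p≢q = s⊂s (⊆∧≢⇒⊂ (drop-∷-⊆ p⊆q) (p≢q ∘ cong (inside ∷_)))

∩-monoˡ-⊆ : ∀ {n} {p q : Subset n} (L : Subset n) → p ⊆ q → p ∩ L ⊆ q ∩ L
∩-monoˡ-⊆ {p = p} L p⊆q x∈p∩L with x∈p∩q⁻ p L x∈p∩L
... | x∈p , x∈L = x∈p∩q⁺ (p⊆q x∈p , x∈L)

trace-mono : ∀ {n} {𝓐 𝓑 : Family n} {L x} → (∀ {F} → F ∈ 𝓐 → F ∈ 𝓑) → x ∈ trace 𝓐 L → x ∈ trace 𝓑 L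
trace-mono {L = L} 𝓐⊆𝓑 x∈ with ∈-map⁻ (_∩ L) x∈
... | F , F∈ , refl = ∈-map⁺ (_∩ L) (𝓐⊆𝓑 F∈)

copy-mono : ∀ {n P} {𝓐 𝓑 : Family n} → (∀ {F} → F ∈ 𝓐 → F ∈ 𝓑) → CopyOf P 𝓐 → CopyOf P 𝓑
copy-mono 𝓐⊆𝓑 (i , i∈ , i-inj , i-ord) = i , 𝓐⊆𝓑 ∘ i∈ , i-inj , i-ord

length-filter-split : ∀ {A : Set} {P : A → Set} (P? : Decidable P) (xs : List A) →
                      length (filter P? xs) + length (filter (∁? P?) xs) ≡ length xs
length-filter-split P? [] = refl
length-filter-split P? (x ∷ xs) with P? x
... | yes _ = cong suc (length-filter-split P? xs)
... | no _  = trans (ℕP.+-suc _ _) (cong suc (length-filter-split P? xs))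

-- From copies of T^{⊗2} to copies of T^s in traces

traceMatching : ∀ {n t} (g : Path 2 t → Subset n) → Injective _≡_ _≡_ g →
                (L : Subset n) → ∣ L ∣ ≡ n ∸ 1 → Matching t
traceMatching {t = t} g g-inj L ∣L∣ = record
  { _~_          = _~_
  ; ~-sym        = λ (u≢v , eq) → u≢v ∘ sym , sym eq
  ; ~-functional = functional
  ; _~?_         = λ u v → ¬? (u ≟Path v) ×-dec ((g u ∩ L) ≟S (g v ∩ L)) }
  where
  _~_ : Path 2 t → Path 2 t → Set
  u ~ v = u ≢ v × g u ∩ L ≡ g v ∩ L

  functional : ∀ {u v w} → u ~ v → u ~ w → v ≡ w
  functional {u} {v} {w} (u≢v , eqv) (u≢w , eqw) with trace-collision L (g u) (g v) (g w) ∣L∣ eqv eqw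
  ... | inj₁ gu≡gv        = ⊥-elim (u≢v (g-inj gu≡gv))
  ... | inj₂ (inj₁ gu≡gw) = ⊥-elim (u≢w (g-inj gu≡gw))
  ... | inj₂ (inj₂ gv≡gw) = g-inj gv≡gw

  _≟Path_ : DecidableEquality (Path 2 t)
  u ≟Path v = map′ toTensor-injective (cong toTensor) (toTensor u ≟P toTensor v)

toTensor-pick-rootOf : ∀ {r t} (β : Pos t → Fin r) → toTensor (pick β (rootOf t)) ≡ rootOf (tensor r t)
toTensor-pick-rootOf {t = node c f} β = refl

-- A copy of T^{⊗2} in 𝓐 yields a copy of T in the trace of 𝓐 on any
-- (n-1)-set L, with top the trace of the old top: pick the copies of T in
-- T^{⊗2} by a choice avoiding the matching of equal traces.
traceCopy : ∀ {n} (T : RTree) {𝓐 : Family n} (L : Subset n) → ∣ L ∣ ≡ n ∸ 1 →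
            (cp : CopyOf (treePoset (tensor 2 T)) 𝓐) →
            Σ (CopyOf (treePoset T) (trace 𝓐 L)) λ cp' → proj₁ cp' (rootOf T) ≡ proj₁ cp (rootOf (tensor 2 T)) ∩ L
traceCopy {n} T L ∣L∣ (g , g∈ , g-inj , g-ord) =
  (φ , (λ p → ∈-map⁺ (_∩ L) (g∈ _)) , φ-inj , φ-ord) , cong (λ x → g x ∩ L) (toTensor-pick-rootOf β)
  where
  M : Matching T
  M = traceMatching (g ∘ toTensor) (λ eq → toTensor-injective (g-inj eq)) L ∣L∣

  β : Pos T → Fin 2
  β = proj₁ (avoidingChoice (postorder T) (postorder-subtreeFirst T) M)

  β-avoids : Avoids M (postorder T) β
  β-avoids = proj₂ (avoidingChoice (postorder T) (postorder-subtreeFirst T) M)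

  φ : Pos T → Subset n
  φ p = g (toTensor (pick β p)) ∩ L

  φ-inj : Injective _≡_ _≡_ φ
  φ-inj {p} {q} eq with p ≟P q
  ... | yes p≡q = p≡q
  ... | no p≢q  = ⊥-elim (β-avoids (∈-postorder p) (∈-postorder q) p≢q (p≢q ∘ pick-injective β , eq))

  φ-ord : ∀ p q → p ⊏ q → φ p ⊂ φ q
  φ-ord p q p⊏q = ⊆∧≢⇒⊂ (∩-monoˡ-⊆ L (proj₁ (g-ord _ _ (pick-monotone β p⊏q))))
                        (λ eq → ⊏-irrefl (subst (_⊏ q) (φ-inj eq) p⊏q))

Distinct : ∀ {n k} → Vec (Subset n) k → Set
Distinct {k = k} v = ∀ (i j : Fin k) → lookup v i ≡ lookup v j → i ≡ j

StrictlyAbove : ∀ {n k} → Family n → Subset n → Vec (Subset n) k → Set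
StrictlyAbove {k = k} 𝓐 A v = ∀ (i : Fin k) → lookup v i ∈ 𝓐 × A ⊂ lookup v i

-- A copy of T in 𝓐 whose top lies strictly below k distinct members of 𝓐
-- extends to a copy of T^{k+1}: the top and those k sets are its maxima.
powerCopy : ∀ {n c f k} {𝓐 : Family n} (cp : CopyOf (treePoset (node c f)) 𝓐) (v : Vec (Subset n) k) →
            Distinct v → StrictlyAbove 𝓐 (proj₁ cp root) v → CopyOf (Pow (node c f) (suc k)) 𝓐
powerCopy {n} {c} {f} {k} (φ , φ∈ , φ-inj , φ-ord) v v-distinct v-above = ψ , ψ∈ , ψ-inj , ψ-ord
  where
  ψ : (Σ (Fin c) λ j → Pos (f j)) ⊎ Fin (suc k) → Subset n
  ψ (inj₁ (j , p))  = φ (sub j p)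
  ψ (inj₂ 0F)       = φ root
  ψ (inj₂ (Fin.suc i)) = lookup v i

  ψ∈ : ∀ x → ψ x ∈ _
  ψ∈ (inj₁ (j , p))      = φ∈ (sub j p)
  ψ∈ (inj₂ 0F)           = φ∈ root
  ψ∈ (inj₂ (Fin.suc i))  = proj₁ (v-above i)

  below-top : ∀ j p → φ (sub j p) ⊂ φ root
  below-top j p = φ-ord _ _ below-root

  below-maxima : ∀ j p i → ψ (inj₁ (j , p)) ⊂ ψ (inj₂ i)
  below-maxima j p 0F          = below-top j p
  below-maxima j p (Fin.suc i) = ⊂-trans (below-top j p) (proj₂ (v-above i))

  ψ-inj : Injective _≡_ _≡_ ψ
  ψ-inj {inj₁ (j , p)} {inj₁ (j' , q)} eq with φ-inj eq
  ... | refl = refl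
  ψ-inj {inj₁ (j , p)} {inj₂ i} eq = ⊥-elim (⊂-irref eq (below-maxima j p i))
  ψ-inj {inj₂ i} {inj₁ (j , p)} eq = ⊥-elim (⊂-irref (sym eq) (below-maxima j p i))
  ψ-inj {inj₂ 0F} {inj₂ 0F} eq = refl
  ψ-inj {inj₂ 0F} {inj₂ (Fin.suc i)} eq = ⊥-elim (⊂-irref eq (proj₂ (v-above i)))
  ψ-inj {inj₂ (Fin.suc i)} {inj₂ 0F} eq = ⊥-elim (⊂-irref (sym eq) (proj₂ (v-above i)))
  ψ-inj {inj₂ (Fin.suc i)} {inj₂ (Fin.suc i')} eq = cong (inj₂ ∘ Fin.suc) (v-distinct i i' eq)

  ψ-ord : ∀ x y → PowLt (suc k) x y → ψ x ⊂ ψ y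
  ψ-ord _ _ (old p⊏q)               = φ-ord _ _ p⊏q
  ψ-ord (inj₁ (j , p)) (inj₂ i) top = below-maxima j p i

-- Covered sets

Covered : ∀ {n} → Family n → ℕ → Subset n → Set
Covered {n} 𝓕 k F = Σ (Subset n) λ L → ∣ L ∣ ≡ n ∸ 1 ×
  Σ (Vec (Subset n) k) λ v → Distinct v × StrictlyAbove (trace 𝓕 L) (F ∩ L) v

anyVec? : ∀ {n} k {P : Vec (Subset n) k → Set} → (∀ v → Dec (P v)) → Dec (Σ (Vec (Subset n) k) P)
anyVec? zero    P? = map′ ([] ,_) (λ { ([] , p) → p }) (P? [])
anyVec? (suc k) P? = map′ (λ (x , v , p) → x ∷ v , p) (λ { (x ∷ v , p) → x , v , p })
                          (anySubset? λ x → anyVec? k λ v → P? (x ∷ v))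

covered? : ∀ {n} (𝓕 : Family n) k → Decidable (Covered 𝓕 k)
covered? {n} 𝓕 k F = anySubset? λ L → (∣ L ∣ ℕP.≟ n ∸ 1) ×-dec anyVec? k λ v →
  all? (λ i → all? λ j → (lookup v i ≟S lookup v j) →-dec (i Fin.≟ j)) ×-dec
  all? (λ i → Any.any? (lookup v i ≟S_) (trace 𝓕 L) ×-dec ((F ∩ L) ⊂? lookup v i))

vee-bottom-covered : ∀ {n k} {𝓕 𝓗 : Family n} → (∀ {F} → F ∈ 𝓗 → F ∈ 𝓕) → ∀ L → ∣ L ∣ ≡ n ∸ 1 →
                     CopyOf (Vee k) (trace 𝓗 L) → Σ (Subset n) λ H → H ∈ 𝓗 × Covered 𝓕 k H
vee-bottom-covered {n} {k} {𝓕} 𝓗⊆𝓕 L ∣L∣ (i , i∈ , i-inj , i-ord) with ∈-map⁻ (_∩ L) (i∈ (inj₁ tt))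
... | H , H∈ , bottom≡ = H , H∈ , L , ∣L∣ , v , v-distinct , v-above
  where
  v : Vec (Subset n) k
  v = tabulate (i ∘ inj₂)

  v-distinct : Distinct v
  v-distinct a b eq with i-inj (trans (sym (lookup∘tabulate _ a)) (trans eq (lookup∘tabulate _ b)))
  ... | refl = refl

  v-above : StrictlyAbove (trace 𝓕 L) (H ∩ L) v
  v-above j rewrite lookup∘tabulate (i ∘ inj₂) j =
    trace-mono 𝓗⊆𝓕 (i∈ (inj₂ j)) , subst (_⊂ i (inj₂ j)) bottom≡ (i-ord _ _ up)

uncovered-traceVeeFree : ∀ {n} (𝓕 : Family n) k → TraceFree (n ∸ 1) (Vee k) (filter (∁? (covered? 𝓕 k)) 𝓕)
uncovered-traceVeeFree 𝓕 k L ∣L∣ copy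
  with vee-bottom-covered (λ F∈ → proj₁ (∈-filter⁻ (∁? (covered? 𝓕 k)) {xs = 𝓕} F∈)) L ∣L∣ copy
... | H , H∈ , H-covered = proj₂ (∈-filter⁻ (∁? (covered? 𝓕 k)) {xs = 𝓕} H∈) H-covered

-- For (n-1)-trace T^{k+1}-free 𝓕 the covered members form a T^{⊗2}-free
-- family: a copy with covered top M on L would give a copy of T in 𝓕|_L
-- with top M ∩ L, below k distinct further members of 𝓕|_L.
covered-tensorFree : ∀ {n} c f k (𝓕 : Family n) → TraceFree (n ∸ 1) (Pow (node c f) (suc k)) 𝓕 →
                     Free (treePoset (tensor 2 (node c f))) (filter (covered? 𝓕 k) 𝓕)
covered-tensorFree c f k 𝓕 𝓕-free copy@(g , g∈ , _)
  with ∈-filter⁻ (covered? 𝓕 k) {xs = 𝓕} (g∈ root)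
... | _ , L , ∣L∣ , v , v-distinct , v-above
  with traceCopy (node c f) L ∣L∣ (copy-mono (λ F∈ → proj₁ (∈-filter⁻ (covered? 𝓕 k) {xs = 𝓕} F∈)) copy)
...   | copy' , top≡ =
  𝓕-free L ∣L∣ (powerCopy copy' v v-distinct (subst (λ A → StrictlyAbove _ A v) (sym top≡) v-above))

lemma3p2 : (T : RTree) (s : ℕ) → 2 ≤ s → (n : ℕ) →
    (𝓕 : Family n) → Unique 𝓕 → TraceFree (n ∸ 1) (Pow T s) 𝓕 →
    Σ (Family n) λ 𝓖 → Unique 𝓖 × Free (treePoset (tensor 2 T)) 𝓖 ×
    Σ (Family n) λ 𝓗 → Unique 𝓗 × TraceFree (n ∸ 1) (Vee (s ∸ 1)) 𝓗 ×
    length 𝓕 ≤ length 𝓖 + length 𝓗 + 1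
lemma3p2 (node c f) (suc (suc m)) (s≤s (s≤s z≤n)) n 𝓕 𝓕-unique 𝓕-free =
  𝓖 , UniqueP.filter⁺ covered 𝓕-unique , covered-tensorFree c f k 𝓕 𝓕-free ,
  𝓗 , UniqueP.filter⁺ (∁? covered) 𝓕-unique , uncovered-traceVeeFree 𝓕 k ,
  subst (_≤ length 𝓖 + length 𝓗 + 1) (length-filter-split covered 𝓕) (ℕP.m≤m+n _ 1)
  where
  k : ℕ
  k = suc m

  covered : Decidable (Covered 𝓕 k)
  covered = covered? 𝓕 k

  𝓖 𝓗 : Family n
  𝓖 = filter covered 𝓕
  𝓗 = filter (∁? covered) 𝓕
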